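{- Let $X$ be any set, $M\subseteq X$, and let $\rho$ be an upper closure operator on $\langle\wp(X),\supseteq\rangle$ such that $\rho(M)=M$. If $\rho$ is finitely additive, i.e. $\rho(A\cup B)=\rho(A)\cup\rho(B)$ for all $A,B\subseteq X$, then $\rho(Z)=Z$ for every $Z\subseteq M$.
   Context: An upper closure operator on $\langle\wp(X),\supseteq\rangle$ is a map $\rho:\wp(X)\to\wp(X)$ that is monotone w.r.t. $\subseteq$, idempotent, and satisfies $\rho(A)\subseteq A$ for all $A\subseteq X$. -}

module Defs where

open import Level using (Level; _⊔_)
open import Relation.Unary using (Pred; _⊆_; _≐_; _∪_)

-- Subsets of X are predicates  Pred X ℓ ; equality of subsets is  _≐_
-- (mutual inclusion), since Agda has no extensionality for predicates.

-- Upper closure operator on ⟨℘(X), ⊇⟩: monotone w.r.t. ⊆, idempotent,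
-- and reductive (ρ(A) ⊆ A).
record IsUpperClosure {a ℓ : Level} {X : Set a}
         (ρ : Pred X ℓ → Pred X ℓ) : Set (a ⊔ Level.suc ℓ) where
  field
    monotone   : ∀ {A B : Pred X ℓ} → A ⊆ B → ρ A ⊆ ρ B
    idempotent : ∀ (A : Pred X ℓ) → ρ (ρ A) ≐ ρ A
    reductive  : ∀ (A : Pred X ℓ) → ρ A ⊆ A

FinitelyAdditive : {a ℓ : Level} {X : Set a} →
                   (Pred X ℓ → Pred X ℓ) → Set (a ⊔ Level.suc ℓ)
FinitelyAdditive {X = X} ρ = ∀ (A B : Pred X _) → ρ (A ∪ B) ≐ (ρ A ∪ ρ B)

{-# OPTIONS --safe #-}
module Submission where

-- With excluded middle, M ⊆ Z ∪ ∁Z. Hence a point of Z lies in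
-- M ⊆ ρ M ⊆ ρ (Z ∪ ∁Z) = ρ Z ∪ ρ (∁Z) ⊆ ρ Z ∪ ∁Z, and so in ρ Z.

open import Defs
open import Level using (Level)
open import Relation.Unary using (Pred; _⊆_; _≐_; _∪_; ∁)
open import Axiom.ExcludedMiddle using (ExcludedMiddle)
open import Relation.Nullary using (yes; no)
open import Data.Sum using (inj₁; inj₂; [_,_])
open import Data.Product using (_,_; proj₁; proj₂)
open import Data.Empty using (⊥-elim)

module _ {a ℓ : Level} {X : Set a} where

  ⊆-∪-∁ : ExcludedMiddle ℓ → (A B : Pred X ℓ) → A ⊆ B ∪ ∁ B
  ⊆-∪-∁ em A B {x} _ with em {B x}
  ... | yes x∈B = inj₁ x∈B
  ... | no  x∉B = inj₂ x∉B

  module _ {ρ : Pred X ℓ → Pred X ℓ}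
           (additive : FinitelyAdditive ρ)
           (reductive : ∀ A → ρ A ⊆ A) where

    ρ-∪-⊆ : ∀ A B → ρ (A ∪ B) ⊆ ρ A ∪ B
    ρ-∪-⊆ A B x∈ρ[A∪B] =
      [ inj₁ , (λ x∈ρB → inj₂ (reductive B x∈ρB)) ] (proj₁ (additive A B) x∈ρ[A∪B])

    ⊆ρ-downward-closed : ExcludedMiddle ℓ →
                        (∀ {A B} → A ⊆ B → ρ A ⊆ ρ B) →
                        ∀ {M Z} → M ⊆ ρ M → Z ⊆ M → Z ⊆ ρ Z
    ⊆ρ-downward-closed em monotone {M} {Z} M⊆ρM Z⊆M {x} x∈Z =
      [ (λ x∈ρZ → x∈ρZ) , (λ x∉Z → ⊥-elim (x∉Z x∈Z)) ] (ρ-∪-⊆ Z (∁ Z) x∈ρ[Z∪∁Z])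
      where
        x∈ρ[Z∪∁Z] : ρ (Z ∪ ∁ Z) x
        x∈ρ[Z∪∁Z] = monotone (⊆-∪-∁ em M Z) (M⊆ρM (Z⊆M x∈Z))

lemma4 : ∀ {a ℓ : Level} {X : Set a} →
           ExcludedMiddle ℓ →
           (M : Pred X ℓ) (ρ : Pred X ℓ → Pred X ℓ) →
           IsUpperClosure ρ →
           ρ M ≐ M →
           FinitelyAdditive ρ →
           ∀ (Z : Pred X ℓ) → Z ⊆ M → ρ Z ≐ Z
lemma4 em M ρ upper ρM≐M additive Z Z⊆M =
  reductive Z , ⊆ρ-downward-closed additive reductive em monotone (proj₂ ρM≐M) Z⊆M
  where open IsUpperClosure upper
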